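{- For every $n\in\mathbb{N}$ and all words $A_1,A_2$ with $A_1\sim A_2$, we have $A_1n\sim A_2n$. Moreover, for all $n\in\mathbb{N}$, $A_1\in\mathsf{NF}$ and any word $A_2$ with $A_1\sim A_2$, we have $\Diamond_nA_1\sim A_2n$.
   Context: A word is a finite string over $\mathbb{N}$; $\Lambda$ is the empty word, $AB$ is concatenation, $An$ is $A$ followed by the symbol $n$. $\mathsf{S}_k$ is the set of words all of whose symbols are $\ge k$. A relation $\precsim$ on words is defined by induction on (maximal symbol minus minimal symbol) of $AB$: $\Lambda\precsim\Lambda$; if $AB$ is nonempty with minimal symbol $n$, write uniquely $A=A_1n\dots nA_k$, $B=B_1n\dots nB_l$ with $k,l\ge1$ and all $A_i,B_j\in\mathsf{S}_{n+1}$; let $(C_1,\dots,C_f)$, $(D_1,\dots,D_g)$ be lexicographically maximal subsequences of $(A_1,\dots,A_k)$, $(B_1,\dots,B_l)$; then $A\precsim B$ iff $(C_i)$ is lexicographically not greater than $(D_j)$. Here $(X_1,\dots,X_p)$ is lexicographically not greater than $(Y_1,\dots,Y_q)$ iff either $p\le q$ and $X_i\sim Y_i$ for all $i\le p$, or there is $s<\min(p,q)$ with $X_i\sim Y_i$ for $i\le s$ and $X_{s+1}\precsim Y_{s+1}$; a lexicographically maximal subsequence is one lexicographically not less than every subsequence. $A\sim B$ iff $A\precsim B$ and $B\precsim A$. $\mathsf{NF}$: $\Lambda\in\mathsf{NF}$; a nonempty word with minimal symbol $n$, written $A_1n\dots nA_k$ with $k\ge2$, $A_i\in\mathsf{S}_{n+1}$,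 is in $\mathsf{NF}$ iff $A_k\precsim\dots\precsim A_1$ and all $A_i\in\mathsf{NF}$. Every word is equivalent to exactly one word of $\mathsf{NF}$. For $A\in\mathsf{NF}$, $\Diamond_nA$ is the unique word of $\mathsf{NF}$ equivalent to $An$. -}

module Defs where

open import Data.Nat using (ℕ; zero; suc; _⊓_; _⊔_; _≟_)
open import Data.List using (List; []; _∷_; _++_; [_]; foldr; length)
open import Data.List.Relation.Unary.All using (All)
open import Data.List.Relation.Binary.Sublist.Propositional using (_⊆_)
open import Data.Product using (_×_; Σ)
open import Data.Sum using (_⊎_)
open import Data.Unit using (⊤)
open import Data.Empty using (⊥)
open import Relation.Nullary using (¬_; yes; no)

Word : Set
Word = List ℕ

minW : ℕ → List ℕ → ℕ
minW x xs = foldr _⊓_ x xs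

maxW : Word → ℕ
maxW = foldr _⊔_ 0

-- split n A = (A_1, …, A_k) where A = A_1 n A_2 n … n A_k (k ≥ 1)
split : ℕ → Word → List Word
split n [] = [] ∷ []
split n (x ∷ xs) with x ≟ n | split n xs
... | yes _ | bs = [] ∷ bs
... | no _  | []       = (x ∷ []) ∷ []
... | no _  | (b ∷ bs) = (x ∷ b) ∷ bs

-- The relation ≾, defined with a fuel parameter which replaces the
-- induction on (max − min) of AB.
mutual
  rel : ℕ → Word → Word → Set
  rel _ [] [] = ⊤
  rel zero _ _ = ⊥
  rel (suc f) [] (y ∷ ys) = relStep f (minW y ys) [] (y ∷ ys)
  rel (suc f) (x ∷ xs) B = relStep f (minW x (xs ++ B)) (x ∷ xs) B

  relStep : ℕ → ℕ → Word → Word → Set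
  relStep f n A B =
    Σ (List Word) λ C → Σ (List Word) λ D →
      LexMax f (split n A) C × LexMax f (split n B) D × LexLe f C D

  lt : ℕ → Word → Word → Set
  lt f X Y = rel f X Y × ¬ rel f Y X

  eqv : ℕ → Word → Word → Set
  eqv f X Y = rel f X Y × rel f Y X

  LexLe : ℕ → List Word → List Word → Set
  LexLe f [] ys = ⊤
  LexLe f (x ∷ xs) [] = ⊥
  LexLe f (x ∷ xs) (y ∷ ys) = lt f x y ⊎ (eqv f x y × LexLe f xs ys)

  LexMax : ℕ → List Word → List Word → Set
  LexMax f As C = (C ⊆ As) × ((S : List Word) → S ⊆ As → LexLe f S C)

infix 4 _≾_ _∼_

_≾_ : Word → Word → Set
A ≾ B = rel (suc (maxW (A ++ B))) A B

_∼_ : Word → Word → Set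
A ∼ B = (A ≾ B) × (B ≾ A)

Descending : List Word → Set
Descending [] = ⊤
Descending (x ∷ []) = ⊤
Descending (x ∷ y ∷ r) = (y ≾ x) × Descending (y ∷ r)

NFf : ℕ → Word → Set
NFf _ [] = ⊤
NFf zero (x ∷ xs) = ⊥
NFf (suc f) (x ∷ xs) =
  Descending (split (minW x xs) (x ∷ xs)) × All (NFf f) (split (minW x xs) (x ∷ xs))

NF : Word → Set
NF A = NFf (length A) A

-- D is ◇_n A, i.e. D is the (unique) word of NF equivalent to A n
IsDiamond : ℕ → Word → Word → Set
IsDiamond n A D = NF D × (D ∼ A ++ [ n ])

-- Cut a word whose symbols are at least m at the occurrences of m, read every piece as a
-- tree at level m + 1, and keep of these children only their lexicographically largest
-- subsequence. By induction on the range of the symbols,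
-- A ≾ B holds exactly when the tree of A is lexicographically at most the tree of B, so
-- A ∼ B says that A and B have the same tree. Appending n to A adds, at level n, an empty
-- last piece, whose tree is the least tree, and replaces, at every level m < n, the last
-- piece p by p n, whose tree exceeds that of p. Either way the new children arise from the
-- old ones by appending one tree and deleting what it dominates, and the appended tree is
-- determined by the old children (inductively, through their last element). So the tree of
-- A n depends only on the tree of A, which is the first claim; the second follows by
-- transitivity of ∼, as ◇ₙ A₁ ∼ A₁ n.

module Submission where

open import Defs
open import Data.Bool using (if_then_else_)
open import Data.Empty using (⊥; ⊥-elim)
open import Data.List using (List; []; _∷_; _++_; [_]; map; foldr)
open import Data.List.Properties using (map-++; ++-assoc; ++-identityʳ; ∷ʳ-injectiveʳ)
open import Data.List.Relation.Binary.Sublist.Propositional using (_⊆_; []; _∷_; _∷ʳ_; minimum)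
open import Data.List.Relation.Binary.Sublist.Propositional.Properties using (All-resp-⊆; map⁺)
open import Data.List.Relation.Unary.All using (All; []; _∷_)
import Data.List.Relation.Unary.All as All
open import Data.List.Relation.Unary.All.Properties
  using (++⁺; ++⁻ˡ; ++⁻ʳ) renaming (map⁺ to All-map⁺)
open import Data.List.Relation.Unary.Linked using (Linked; []; [-]; _∷_)
open import Data.Nat using (ℕ; zero; suc; _+_; _≤_; _<_; _≟_; _⊔_; z≤n; s≤s)
open import Data.Nat.Properties
  using ( ≤-refl; ≤-trans; <-≤-trans; <⇒≱; <⇒≢; m≤n⇒m<n∨m≡n; m≤n⇒m≤1+n; +-suc; +-identityʳ
        ; ⊓-glb; m⊓n≤m; m⊓n≤n; ⊔-lub; m≤m⊔n; m≤n⊔m; m≤n⇒m≤o⊔n; m≤n⇒m≤n⊔o)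
open import Data.Product using (_×_; _,_; proj₁; proj₂; ∃; ∃₂)
open import Data.Sum using (_⊎_; inj₁; inj₂)
open import Data.Unit using (⊤; tt)
open import Function using (id; _∘_)
open import Function.Bundles using (_⇔_; mk⇔; Equivalence)
open import Relation.Binary.PropositionalEquality
  using (_≡_; _≢_; refl; sym; trans; cong; cong₂; subst; subst₂; ≢-sym; module ≡-Reasoning)
open import Relation.Nullary using (¬_; Dec; yes; no; does)
open import Relation.Nullary.Decidable using (dec-true; dec-false)

open Equivalence using (to; from)
open ≡-Reasoning

-- Rose trees and their lexicographic order

data Ordering : Set where
  LT EQ GT : Ordering

invert : Ordering → Ordering
invert LT = GT
invert EQ = EQ
invert GT = LT

infixr 5 _then_

_then_ : Ordering → Ordering → Ordering
LT then _ = LT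
EQ then o = o
GT then _ = GT

NotGT : Ordering → Set
NotGT GT = ⊥
NotGT _  = ⊤

data Tree : Set where
  node : List Tree → Tree

children : Tree → List Tree
children (node ts) = ts

mutual
  compare : Tree → Tree → Ordering
  compare (node ss) (node ts) = compareList ss ts

  compareList : List Tree → List Tree → Ordering
  compareList []       []       = EQ
  compareList []       (_ ∷ _)  = LT
  compareList (_ ∷ _)  []       = GT
  compareList (s ∷ ss) (t ∷ ts) = compare s t then compareList ss ts

-- These relations compute, so their tree arguments can seldom be inferred and are
-- often passed explicitly.
infix 4 _≤ₜ_ _<ₜ_ _≥ₜ_ _≤ₗ_ _<ₗ_

_≤ₜ_ _<ₜ_ _≥ₜ_ : Tree → Tree → Set
s ≤ₜ t = NotGT (compare s t)
s <ₜ t = compare s t ≡ LT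
s ≥ₜ t = t ≤ₜ s

_≤ₗ_ _<ₗ_ : List Tree → List Tree → Set
ss ≤ₗ ts = NotGT (compareList ss ts)
ss <ₗ ts = compareList ss ts ≡ LT

mutual
  compare-refl : ∀ t → compare t t ≡ EQ
  compare-refl (node ts) = compareList-refl ts

  compareList-refl : ∀ ts → compareList ts ts ≡ EQ
  compareList-refl []       = refl
  compareList-refl (t ∷ ts) rewrite compare-refl t = compareList-refl ts

invert-then : ∀ o p → invert (o then p) ≡ invert o then invert p
invert-then LT p = refl
invert-then EQ p = refl
invert-then GT p = refl

mutual
  compare-invert : ∀ s t → compare t s ≡ invert (compare s t)
  compare-invert (node ss) (node ts) = compareList-invert ss ts

  compareList-invert : ∀ ss ts → compareList ts ss ≡ invert (compareList ss ts)
  compareList-invert []       []       = refl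
  compareList-invert []       (_ ∷ _)  = refl
  compareList-invert (_ ∷ _)  []       = refl
  compareList-invert (s ∷ ss) (t ∷ ts)
    rewrite compare-invert s t | compareList-invert ss ts =
      sym (invert-then (compare s t) (compareList ss ts))

then-EQ-identityʳ : ∀ o → o then EQ ≡ o
then-EQ-identityʳ LT = refl
then-EQ-identityʳ EQ = refl
then-EQ-identityʳ GT = refl

then-EQ : ∀ o p → o then p ≡ EQ → o ≡ EQ × p ≡ EQ
then-EQ EQ p e = refl , e

mutual
  compare-EQ⇒≡ : ∀ s t → compare s t ≡ EQ → s ≡ t
  compare-EQ⇒≡ (node ss) (node ts) e = cong node (compareList-EQ⇒≡ ss ts e)

  compareList-EQ⇒≡ : ∀ ss ts → compareList ss ts ≡ EQ → ss ≡ ts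
  compareList-EQ⇒≡ []       []       _ = refl
  compareList-EQ⇒≡ (s ∷ ss) (t ∷ ts) e with then-EQ (compare s t) _ e
  ... | e₁ , e₂ = cong₂ _∷_ (compare-EQ⇒≡ s t e₁) (compareList-EQ⇒≡ ss ts e₂)

then-LT : ∀ o p → o then p ≡ LT → o ≡ LT ⊎ (o ≡ EQ × p ≡ LT)
then-LT LT p e = inj₁ refl
then-LT EQ p e = inj₂ (refl , e)

mutual
  <ₜ-trans : ∀ {s t u} → s <ₜ t → t <ₜ u → s <ₜ u
  <ₜ-trans {node ss} {node ts} {node us} = <ₗ-trans {ss} {ts} {us}

  <ₗ-trans : ∀ {ss ts us} → ss <ₗ ts → ts <ₗ us → ss <ₗ us
  <ₗ-trans {[]}     {_ ∷ _}  {_ ∷ _}  _ _ = refl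
  <ₗ-trans {s ∷ ss} {t ∷ ts} {u ∷ us} p q
    with then-LT (compare s t) _ p | then-LT (compare t u) _ q
  ... | inj₁ s<t        | inj₁ t<u rewrite <ₜ-trans {s} s<t t<u = refl
  ... | inj₁ s<t        | inj₂ (t≡u , _)
    rewrite compare-EQ⇒≡ t u t≡u | s<t = refl
  ... | inj₂ (s≡t , _)  | inj₁ t<u
    rewrite compare-EQ⇒≡ s t s≡t | t<u = refl
  ... | inj₂ (s≡t , p′) | inj₂ (t≡u , q′)
    rewrite compare-EQ⇒≡ s t s≡t | compare-EQ⇒≡ t u t≡u | compare-refl u =
      <ₗ-trans {ss} p′ q′

≤ₜ-refl : ∀ t → t ≤ₜ t
≤ₜ-refl t rewrite compare-refl t = tt

≤ₜ-reflexive : ∀ {s t} → s ≡ t → s ≤ₜ t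
≤ₜ-reflexive {s} refl = ≤ₜ-refl s

≤ₜ⇒<ₜ⊎≡ : ∀ {s t} → s ≤ₜ t → s <ₜ t ⊎ s ≡ t
≤ₜ⇒<ₜ⊎≡ {s} {t} p with compare s t in e | p
... | LT | _ = inj₁ refl
... | EQ | _ = inj₂ (compare-EQ⇒≡ s t e)

<ₜ⇒≤ₜ : ∀ {s t} → s <ₜ t → s ≤ₜ t
<ₜ⇒≤ₜ p rewrite p = tt

<ₜ⇒≱ₜ : ∀ {s t} → s <ₜ t → ¬ s ≥ₜ t
<ₜ⇒≱ₜ {s} {t} p rewrite compare-invert s t | p = id

≥ₜ⇒≮ₜ : ∀ {s t} → s ≥ₜ t → ¬ s <ₜ t
≥ₜ⇒≮ₜ {s} s≥t s<t = <ₜ⇒≱ₜ {s} s<t s≥t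

≮ₜ⇒≥ₜ : ∀ {s t} → ¬ s <ₜ t → s ≥ₜ t
≮ₜ⇒≥ₜ {s} {t} ¬p rewrite compare-invert s t with compare s t
... | LT = ¬p refl
... | EQ = tt
... | GT = tt

<ₜ-≤ₜ-trans : ∀ {s t u} → s <ₜ t → t ≤ₜ u → s <ₜ u
<ₜ-≤ₜ-trans {s} {t} {u} p q with ≤ₜ⇒<ₜ⊎≡ {t} {u} q
... | inj₁ t<u  = <ₜ-trans {s} p t<u
... | inj₂ refl = p

≤ₜ-trans : ∀ {s t u} → s ≤ₜ t → t ≤ₜ u → s ≤ₜ u
≤ₜ-trans {s} {t} {u} p q with ≤ₜ⇒<ₜ⊎≡ {s} {t} p
... | inj₁ s<t  = <ₜ⇒≤ₜ {s} (<ₜ-≤ₜ-trans {s} s<t q)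
... | inj₂ refl = q

≤ₜ-antisym : ∀ {s t} → s ≤ₜ t → t ≤ₜ s → s ≡ t
≤ₜ-antisym {s} {t} p q with ≤ₜ⇒<ₜ⊎≡ {s} {t} p
... | inj₁ s<t = ⊥-elim (<ₜ⇒≱ₜ {s} s<t q)
... | inj₂ s≡t = s≡t

≤ₗ-trans : ∀ {ss ts us} → ss ≤ₗ ts → ts ≤ₗ us → ss ≤ₗ us
≤ₗ-trans {ss} {ts} {us} = ≤ₜ-trans {node ss} {node ts} {node us}

∷-mono-≤ₗ : ∀ {s t ss ts} → s ≤ₜ t → ss ≤ₗ ts → s ∷ ss ≤ₗ t ∷ ts
∷-mono-≤ₗ {s} {t} p q with compare s t | p
... | LT | _ = tt
... | EQ | _ = q

[]-≤ₗ : ∀ ts → [] ≤ₗ ts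
[]-≤ₗ []      = tt
[]-≤ₗ (_ ∷ _) = tt

_<?_ : ∀ s t → Dec (s <ₜ t)
s <? t with compare s t
... | LT = yes refl
... | EQ = no λ ()
... | GT = no λ ()

<ₜ⊎≥ₜ : ∀ s t → s <ₜ t ⊎ s ≥ₜ t
<ₜ⊎≥ₜ s t with s <? t
... | yes s<t = inj₁ s<t
... | no  s≮t = inj₂ (≮ₜ⇒≥ₜ {s} s≮t)

-- Lexicographically maximal subsequences

consMax : {A : Set} → (A → Tree) → A → List A → List A
consMax key x []      = x ∷ []
consMax key x (h ∷ r) = if does (key x <? key h) then h ∷ r else x ∷ h ∷ r

-- The weak suffix maxima of a list, in order.
maxSubseq : {A : Set} → (A → Tree) → List A → List A
maxSubseq key = foldr (consMax key) []

module _ {A : Set} (key : A → Tree) where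

  consMax-⊆ : ∀ x {r xs} → r ⊆ xs → consMax key x r ⊆ x ∷ xs
  consMax-⊆ x {[]}    _ = refl ∷ minimum _
  consMax-⊆ x {h ∷ r} p with key x <? key h
  ... | yes _ = x ∷ʳ p
  ... | no  _ = refl ∷ p

  maxSubseq-⊆ : ∀ xs → maxSubseq key xs ⊆ xs
  maxSubseq-⊆ []       = []
  maxSubseq-⊆ (x ∷ xs) = consMax-⊆ x (maxSubseq-⊆ xs)

  map-consMax : ∀ x r → map key (consMax key x r) ≡ consMax id (key x) (map key r)
  map-consMax x []      = refl
  map-consMax x (h ∷ r) with key x <? key h
  ... | yes _ = refl
  ... | no  _ = refl

  map-maxSubseq : ∀ xs → map key (maxSubseq key xs) ≡ maxSubseq id (map key xs)
  map-maxSubseq []       = refl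
  map-maxSubseq (x ∷ xs) rewrite sym (map-maxSubseq xs) = map-consMax x (maxSubseq key xs)

consMax-< : ∀ {x h} r → x <ₜ h → consMax id x (h ∷ r) ≡ h ∷ r
consMax-< {x} {h} r x<h rewrite dec-true (x <? h) x<h = refl

consMax-≥ : ∀ {x h} r → x ≥ₜ h → consMax id x (h ∷ r) ≡ x ∷ h ∷ r
consMax-≥ {x} {h} r x≥h rewrite dec-false (x <? h) (≥ₜ⇒≮ₜ {x} x≥h) = refl

Sorted≥ : List Tree → Set
Sorted≥ = Linked _≥ₜ_

consMax-sorted : ∀ x {r} → Sorted≥ r → Sorted≥ (consMax id x r)
consMax-sorted x {[]}    _ = [-]
consMax-sorted x {h ∷ r} p with x <? h
... | yes _   = p
... | no  x≮h = ≮ₜ⇒≥ₜ {x} x≮h ∷ p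

maxSubseq-sorted : ∀ ts → Sorted≥ (maxSubseq id ts)
maxSubseq-sorted []       = []
maxSubseq-sorted (t ∷ ts) = consMax-sorted t (maxSubseq-sorted ts)

tail-≤ₗ : ∀ {t ts} → Sorted≥ (t ∷ ts) → ts ≤ₗ t ∷ ts
tail-≤ₗ [-]                    = tt
tail-≤ₗ {t} {u ∷ ts} (t≥u ∷ p) = ∷-mono-≤ₗ {u} {t} {ts} t≥u (tail-≤ₗ p)

≤ₗ-consMax : ∀ x {r} → Sorted≥ r → r ≤ₗ consMax id x r
≤ₗ-consMax x {[]}    _ = tt
≤ₗ-consMax x {h ∷ r} p with x <? h
... | yes _   = ≤ₜ-refl (node (h ∷ r))
... | no  x≮h = tail-≤ₗ (≮ₜ⇒≥ₜ {x} x≮h ∷ p)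

∷-≤ₗ-consMax : ∀ x {ss r} → ss ≤ₗ r → x ∷ ss ≤ₗ consMax id x r
∷-≤ₗ-consMax x {ss} {[]}    p = ∷-mono-≤ₗ {x} {x} {ss} (≤ₜ-refl x) p
∷-≤ₗ-consMax x {ss} {h ∷ r} p with x <? h
... | yes x<h rewrite x<h = tt
... | no  _   = ∷-mono-≤ₗ {x} {x} {ss} (≤ₜ-refl x) p

⊆⇒≤ₗ-maxSubseq : ∀ {ss ts} → ss ⊆ ts → ss ≤ₗ maxSubseq id ts
⊆⇒≤ₗ-maxSubseq []                  = tt
⊆⇒≤ₗ-maxSubseq {ss} {t ∷ ts} (.t ∷ʳ p) =
  ≤ₗ-trans {ss} (⊆⇒≤ₗ-maxSubseq p) (≤ₗ-consMax t (maxSubseq-sorted ts))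
⊆⇒≤ₗ-maxSubseq {t ∷ ss} {.t ∷ ts} (refl ∷ p) =
  ∷-≤ₗ-consMax t {ss} (⊆⇒≤ₗ-maxSubseq p)

snocMax : List Tree → Tree → List Tree
snocMax []      y = y ∷ []
snocMax (h ∷ r) y = if does (h <? y) then y ∷ [] else h ∷ snocMax r y

snocMax-< : ∀ {h y} r → h <ₜ y → snocMax (h ∷ r) y ≡ y ∷ []
snocMax-< {h} {y} r h<y rewrite dec-true (h <? y) h<y = refl

snocMax-≥ : ∀ {h y} r → h ≥ₜ y → snocMax (h ∷ r) y ≡ h ∷ snocMax r y
snocMax-≥ {h} {y} r h≥y rewrite dec-false (h <? y) (≥ₜ⇒≮ₜ {h} h≥y) = refl

consMax-snocMax : ∀ x r y → consMax id x (snocMax r y) ≡ snocMax (consMax id x r) y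
consMax-snocMax x []      y = refl
consMax-snocMax x (h ∷ r) y with <ₜ⊎≥ₜ h y | <ₜ⊎≥ₜ x h
... | inj₁ h<y | inj₁ x<h = begin
  consMax id x (snocMax (h ∷ r) y)  ≡⟨ cong (consMax id x) (snocMax-< {h} r h<y) ⟩
  consMax id x (y ∷ [])             ≡⟨ consMax-< {x} [] (<ₜ-trans {x} x<h h<y) ⟩
  y ∷ []                            ≡⟨ snocMax-< {h} r h<y ⟨
  snocMax (h ∷ r) y                 ≡⟨ cong (λ l → snocMax l y) (consMax-< {x} r x<h) ⟨
  snocMax (consMax id x (h ∷ r)) y  ∎
... | inj₁ h<y | inj₂ x≥h = begin
  consMax id x (snocMax (h ∷ r) y)  ≡⟨ cong (consMax id x) (snocMax-< {h} r h<y) ⟩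
  consMax id x (y ∷ [])             ≡⟨ cong (λ l → if does (x <? y) then y ∷ [] else x ∷ l)
                                            (snocMax-< {h} r h<y) ⟨
  snocMax (x ∷ h ∷ r) y             ≡⟨ cong (λ l → snocMax l y) (consMax-≥ {x} r x≥h) ⟨
  snocMax (consMax id x (h ∷ r)) y  ∎
... | inj₂ h≥y | inj₁ x<h = begin
  consMax id x (snocMax (h ∷ r) y)  ≡⟨ cong (consMax id x) (snocMax-≥ {h} r h≥y) ⟩
  consMax id x (h ∷ snocMax r y)    ≡⟨ consMax-< {x} (snocMax r y) x<h ⟩
  h ∷ snocMax r y                   ≡⟨ snocMax-≥ {h} r h≥y ⟨
  snocMax (h ∷ r) y                 ≡⟨ cong (λ l → snocMax l y) (consMax-< {x} r x<h) ⟨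
  snocMax (consMax id x (h ∷ r)) y  ∎
... | inj₂ h≥y | inj₂ x≥h = begin
  consMax id x (snocMax (h ∷ r) y)  ≡⟨ cong (consMax id x) (snocMax-≥ {h} r h≥y) ⟩
  consMax id x (h ∷ snocMax r y)    ≡⟨ consMax-≥ {x} (snocMax r y) x≥h ⟩
  x ∷ h ∷ snocMax r y               ≡⟨ cong (x ∷_) (snocMax-≥ {h} r h≥y) ⟨
  x ∷ snocMax (h ∷ r) y             ≡⟨ snocMax-≥ {x} (h ∷ r) (≤ₜ-trans {y} h≥y x≥h) ⟨
  snocMax (x ∷ h ∷ r) y             ≡⟨ cong (λ l → snocMax l y) (consMax-≥ {x} r x≥h) ⟨
  snocMax (consMax id x (h ∷ r)) y  ∎

maxSubseq-snoc : ∀ ts y → maxSubseq id (ts ++ [ y ]) ≡ snocMax (maxSubseq id ts) y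
maxSubseq-snoc []       y = refl
maxSubseq-snoc (t ∷ ts) y = begin
  consMax id t (maxSubseq id (ts ++ [ y ]))  ≡⟨ cong (consMax id t) (maxSubseq-snoc ts y) ⟩
  consMax id t (snocMax (maxSubseq id ts) y) ≡⟨ consMax-snocMax t (maxSubseq id ts) y ⟩
  snocMax (maxSubseq id (t ∷ ts)) y          ∎

snocMax-∷ʳ : ∀ r y → ∃ λ s → snocMax r y ≡ s ++ [ y ]
snocMax-∷ʳ []      y = [] , refl
snocMax-∷ʳ (h ∷ r) y with <ₜ⊎≥ₜ h y | snocMax-∷ʳ r y
... | inj₁ h<y | _      = [] , snocMax-< {h} r h<y
... | inj₂ h≥y | s , eq = h ∷ s , trans (snocMax-≥ {h} r h≥y) (cong (h ∷_) eq)

snocMax-injectiveʳ : ∀ r r′ {y y′} → snocMax r y ≡ snocMax r′ y′ → y ≡ y′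
snocMax-injectiveʳ r r′ {y} {y′} eq with snocMax-∷ʳ r y | snocMax-∷ʳ r′ y′
... | s , e | s′ , e′ = ∷ʳ-injectiveʳ s s′ (trans (sym e) (trans eq e′))

snocMax-absorb : ∀ r {x y} → x <ₜ y → snocMax (snocMax r x) y ≡ snocMax r y
snocMax-absorb []      {x} x<y = snocMax-< {x} [] x<y
snocMax-absorb (h ∷ r) {x} {y} x<y with <ₜ⊎≥ₜ h x | <ₜ⊎≥ₜ h y
... | inj₁ h<x | _
  rewrite dec-true (h <? x) h<x | dec-true (x <? y) x<y
        | dec-true (h <? y) (<ₜ-trans {h} h<x x<y) = refl
... | inj₂ h≥x | inj₁ h<y
  rewrite dec-false (h <? x) (≥ₜ⇒≮ₜ {h} h≥x) | dec-true (h <? y) h<y = refl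
... | inj₂ h≥x | inj₂ h≥y
  rewrite dec-false (h <? x) (≥ₜ⇒≮ₜ {h} h≥x) | dec-false (h <? y) (≥ₜ⇒≮ₜ {h} h≥y) =
    cong (h ∷_) (snocMax-absorb r x<y)

snocMax-<ₗ : ∀ r {x y} → x <ₜ y → snocMax r x <ₗ snocMax r y
snocMax-<ₗ []      x<y rewrite x<y = refl
snocMax-<ₗ (h ∷ r) {x} {y} x<y with <ₜ⊎≥ₜ h x | <ₜ⊎≥ₜ h y
... | inj₁ h<x | _
  rewrite dec-true (h <? x) h<x | dec-true (h <? y) (<ₜ-trans {h} h<x x<y) | x<y = refl
... | inj₂ h≥x | inj₁ h<y
  rewrite dec-false (h <? x) (≥ₜ⇒≮ₜ {h} h≥x) | dec-true (h <? y) h<y | h<y = refl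
... | inj₂ h≥x | inj₂ h≥y
  rewrite dec-false (h <? x) (≥ₜ⇒≮ₜ {h} h≥x) | dec-false (h <? y) (≥ₜ⇒≮ₜ {h} h≥y)
        | compare-refl h = snocMax-<ₗ r x<y

<ₗ-snocMax-minimum : ∀ {r z} → All (_≥ₜ z) r → r <ₗ snocMax r z
<ₗ-snocMax-minimum []                      = refl
<ₗ-snocMax-minimum {h ∷ r} {z} (h≥z ∷ r≥z)
  rewrite dec-false (h <? z) (≥ₜ⇒≮ₜ {h} h≥z) | compare-refl h = <ₗ-snocMax-minimum r≥z

module Representation (f : ℕ) (key : Word → Tree) (P : Word → Set)
  (rel⇔≤ₜ : ∀ {X Y} → P X → P Y → rel f X Y ⇔ key X ≤ₜ key Y) where

  lt⇒<ₜ : ∀ {X Y} → P X → P Y → lt f X Y → key X <ₜ key Y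
  lt⇒<ₜ {X} {Y} pX pY (X≾Y , Y⋦X) with ≤ₜ⇒<ₜ⊎≡ {key X} (to (rel⇔≤ₜ pX pY) X≾Y)
  ... | inj₁ X<Y = X<Y
  ... | inj₂ X≡Y = ⊥-elim (Y⋦X (from (rel⇔≤ₜ pY pX) (≤ₜ-reflexive (sym X≡Y))))

  eqv⇒≡ : ∀ {X Y} → P X → P Y → eqv f X Y → key X ≡ key Y
  eqv⇒≡ pX pY (X≾Y , Y≾X) = ≤ₜ-antisym (to (rel⇔≤ₜ pX pY) X≾Y) (to (rel⇔≤ₜ pY pX) Y≾X)

  LexLe⇒≤ₗ : ∀ {Ss Cs} → All P Ss → All P Cs → LexLe f Ss Cs → map key Ss ≤ₗ map key Cs
  LexLe⇒≤ₗ {[]} {Cs} _ _ _ = []-≤ₗ (map key Cs)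
  LexLe⇒≤ₗ {S ∷ Ss} {C ∷ Cs} (pS ∷ pSs) (pC ∷ pCs) (inj₁ S≺C)
    rewrite lt⇒<ₜ pS pC S≺C = tt
  LexLe⇒≤ₗ {S ∷ Ss} {C ∷ Cs} (pS ∷ pSs) (pC ∷ pCs) (inj₂ (S∼C , Ss≤Cs))
    rewrite eqv⇒≡ pS pC S∼C | compare-refl (key C) = LexLe⇒≤ₗ pSs pCs Ss≤Cs

  ≤ₗ⇒LexLe : ∀ {Ss Cs} → All P Ss → All P Cs → map key Ss ≤ₗ map key Cs → LexLe f Ss Cs
  ≤ₗ⇒LexLe {[]}               _          _          _ = tt
  ≤ₗ⇒LexLe {S ∷ Ss} {C ∷ Cs} (pS ∷ pSs) (pC ∷ pCs) le with compare (key S) (key C) in e | le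
  ... | LT | _ = inj₁ (from (rel⇔≤ₜ pS pC) (<ₜ⇒≤ₜ {key S} e) ,
                       λ C≾S → <ₜ⇒≱ₜ {key S} e (to (rel⇔≤ₜ pC pS) C≾S))
  ... | EQ | Ss≤Cs = inj₂ ((from (rel⇔≤ₜ pS pC) (≤ₜ-reflexive S≡C) ,
                            from (rel⇔≤ₜ pC pS) (≤ₜ-reflexive (sym S≡C))) ,
                           ≤ₗ⇒LexLe pSs pCs Ss≤Cs)
    where S≡C = compare-EQ⇒≡ (key S) (key C) e

  LexMax-maxSubseq : ∀ {As} → All P As → LexMax f As (maxSubseq key As)
  LexMax-maxSubseq {As} pAs = maxSubseq-⊆ key As , λ Ss Ss⊆As →
    ≤ₗ⇒LexLe (All-resp-⊆ Ss⊆As pAs) (All-resp-⊆ (maxSubseq-⊆ key As) pAs)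
      (subst (map key Ss ≤ₗ_) (sym (map-maxSubseq key As)) (⊆⇒≤ₗ-maxSubseq (map⁺ key Ss⊆As)))

  LexMax⇒≡ : ∀ {As Cs} → All P As → LexMax f As Cs → map key Cs ≡ maxSubseq id (map key As)
  LexMax⇒≡ {As} {Cs} pAs (Cs⊆As , Cs-max) =
    trans (cong children (≤ₜ-antisym {node (map key Cs)} Cs≤M M≤Cs)) (map-maxSubseq key As)
    where
    pCs = All-resp-⊆ Cs⊆As pAs
    pM  = All-resp-⊆ (maxSubseq-⊆ key As) pAs
    M≤Cs = LexLe⇒≤ₗ pM pCs (Cs-max (maxSubseq key As) (maxSubseq-⊆ key As))
    Cs≤M = LexLe⇒≤ₗ pCs pM (proj₂ (LexMax-maxSubseq pAs) Cs Cs⊆As)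

  relStep⇔≤ₗ : ∀ {n X Y} → All P (split n X) → All P (split n Y) →
    relStep f n X Y ⇔ maxSubseq id (map key (split n X)) ≤ₗ maxSubseq id (map key (split n Y))
  relStep⇔≤ₗ {n} {X} {Y} pAs pBs = mk⇔
    (λ (Cs , Ds , Cs-max , Ds-max , Cs≤Ds) →
      subst₂ _≤ₗ_ (LexMax⇒≡ pAs Cs-max) (LexMax⇒≡ pBs Ds-max)
        (LexLe⇒≤ₗ (All-resp-⊆ (proj₁ Cs-max) pAs) (All-resp-⊆ (proj₁ Ds-max) pBs) Cs≤Ds))
    (λ le → maxSubseq key As , maxSubseq key Bs , LexMax-maxSubseq pAs , LexMax-maxSubseq pBs ,
      ≤ₗ⇒LexLe (All-resp-⊆ (maxSubseq-⊆ key As) pAs) (All-resp-⊆ (maxSubseq-⊆ key Bs) pBs)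
        (subst₂ _≤ₗ_ (sym (map-maxSubseq key As)) (sym (map-maxSubseq key Bs)) le))
    where
    As = split n X
    Bs = split n Y

-- Words as trees

-- The depth d is fuel: it suffices once every symbol of A is below m + d,
-- and tree 0 m A = node [] is a junk value otherwise.
tree : ℕ → ℕ → Word → Tree
tree zero    m A = node []
tree (suc d) m A = node (maxSubseq id (map (tree d (suc m)) (split m A)))

InRange : ℕ → ℕ → Word → Set
InRange m b = All (λ x → m ≤ x × x < b)

split-fresh : ∀ m X → All (_≢ m) X → split m X ≡ [ X ]
split-fresh m []       _ = refl
split-fresh m (x ∷ xs) (x≢m ∷ xs≢m) with x ≟ m | split m xs | split-fresh m xs xs≢m
... | yes x≡m | _ | _    = ⊥-elim (x≢m x≡m)
... | no  _   | _ | refl = refl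

split-All : ∀ {P : ℕ → Set} m X → All P X → All (All (λ x → P x × x ≢ m)) (split m X)
split-All m []       _ = [] ∷ []
split-All m (x ∷ xs) (px ∷ pxs) with x ≟ m | split m xs | split-All m xs pxs
... | yes _   | _      | ih          = [] ∷ ih
... | no  x≢m | []     | _           = ((px , x≢m) ∷ []) ∷ []
... | no  x≢m | _ ∷ _  | ih₁ ∷ ihs   = ((px , x≢m) ∷ ih₁) ∷ ihs

InRange-split : ∀ {m b} X → InRange m b X → All (InRange (suc m) b) (split m X)
InRange-split {m} X rX = All.map (All.map raise) (split-All m X rX)
  where
  raise : ∀ {x b} → (m ≤ x × x < b) × x ≢ m → suc m ≤ x × x < b
  raise ((m≤x , x<b) , x≢m) with m≤n⇒m<n∨m≡n m≤x
  ... | inj₁ m<x  = m<x , x<b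
  ... | inj₂ refl = ⊥-elim (x≢m refl)

All-≥⇒≢ : ∀ {m n Z} → m < n → All (n ≤_) Z → All (_≢ m) Z
All-≥⇒≢ m<n = All.map λ { n≤z refl → <⇒≱ m<n n≤z }

InRange-raise : ∀ {m n b Z} → m < n → All (n ≤_) Z → InRange m b Z → InRange (suc m) b Z
InRange-raise m<n []           []               = []
InRange-raise m<n (n≤z ∷ n≤zs) ((_ , z<b) ∷ rZ) =
  (<-≤-trans m<n n≤z , z<b) ∷ InRange-raise m<n n≤zs rZ

minW-≤ : ∀ x xs → All (minW x xs ≤_) (x ∷ xs)
minW-≤ x []       = ≤-refl ∷ []
minW-≤ x (y ∷ ys) with minW-≤ x ys
... | x≥ ∷ ys≥ = ≤-trans (m⊓n≤n y _) x≥ ∷ m⊓n≤m y _ ∷ All.map (≤-trans (m⊓n≤n y _)) ys≥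

≤-minW : ∀ {m} x xs → m ≤ x → All (m ≤_) xs → m ≤ minW x xs
≤-minW x []       m≤x []           = m≤x
≤-minW x (y ∷ ys) m≤x (m≤y ∷ m≤ys) = ⊓-glb m≤y (≤-minW x ys m≤x m≤ys)

¬InRange-∷ : ∀ {m b x xs} → b ≤ m + 0 → ¬ InRange m b (x ∷ xs)
¬InRange-∷ {m} b≤m+0 ((m≤x , x<b) ∷ _) =
  <⇒≱ (<-≤-trans x<b (subst (_ ≤_) (+-identityʳ m) b≤m+0)) m≤x

mutual
  rel⇔tree : ∀ f d m b X Y → b ≤ m + f → b ≤ m + d → InRange m b X → InRange m b Y →
             rel f X Y ⇔ tree d m X ≤ₜ tree d m Y
  rel⇔tree f d m b [] [] _ _ _ _ = mk⇔ (λ _ → ≤ₜ-refl (tree d m [])) (λ _ → tt)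
  rel⇔tree zero    d    m b (x ∷ xs) Y        b≤m+0 _ rX _  = ⊥-elim (¬InRange-∷ b≤m+0 rX)
  rel⇔tree zero    d    m b []       (y ∷ ys) b≤m+0 _ _  rY = ⊥-elim (¬InRange-∷ b≤m+0 rY)
  rel⇔tree (suc f) zero m b (x ∷ xs) Y        _ b≤m+0 rX _  = ⊥-elim (¬InRange-∷ b≤m+0 rX)
  rel⇔tree (suc f) zero m b []       (y ∷ ys) _ b≤m+0 _  rY = ⊥-elim (¬InRange-∷ b≤m+0 rY)
  rel⇔tree (suc f) (suc d) m b (x ∷ xs) Y b≤f b≤d rX rY =
    rel⇔tree-step f d m b (minW x (xs ++ Y)) (x ∷ xs) Y refl b≤f b≤d rX rY
      (minW-≤ x (xs ++ Y))
      (≤-minW x (xs ++ Y) (proj₁ (All.head rX)) (All.map proj₁ (++⁺ (All.tail rX) rY)))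
  rel⇔tree (suc f) (suc d) m b [] (y ∷ ys) b≤f b≤d rX rY =
    rel⇔tree-step f d m b (minW y ys) [] (y ∷ ys) refl b≤f b≤d rX rY
      (minW-≤ y ys) (≤-minW y ys (proj₁ (All.head rY)) (All.map proj₁ (All.tail rY)))

  -- n is the least symbol of X ++ Y. If n > m, both words are a single piece at level m and
  -- the comparison moves to level m + 1 with the same fuel.
  rel⇔tree-step : ∀ f d m b n X Y → rel (suc f) X Y ≡ relStep f n X Y →
    b ≤ m + suc f → b ≤ m + suc d → InRange m b X → InRange m b Y →
    All (n ≤_) (X ++ Y) → m ≤ n →
    rel (suc f) X Y ⇔ tree (suc d) m X ≤ₜ tree (suc d) m Y
  rel⇔tree-step f d m b n X Y step b≤f b≤d rX rY n≤XY m≤n with m≤n⇒m<n∨m≡n m≤n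
  ... | inj₂ refl rewrite step =
    relStep⇔≤ₗ {m} {X} {Y} (InRange-split X rX) (InRange-split Y rY)
    where
    open Representation f (tree d (suc m)) (InRange (suc m) b)
      (rel⇔tree f d (suc m) b _ _ (subst (b ≤_) (+-suc m f) b≤f) (subst (b ≤_) (+-suc m d) b≤d))
  ... | inj₁ m<n
    rewrite split-fresh m X (All-≥⇒≢ m<n (++⁻ˡ X n≤XY))
          | split-fresh m Y (All-≥⇒≢ m<n (++⁻ʳ X n≤XY))
          | then-EQ-identityʳ (compare (tree d (suc m) X) (tree d (suc m) Y)) =
    rel⇔tree (suc f) d (suc m) b X Y (m≤n⇒m≤1+n b≤f) (subst (b ≤_) (+-suc m d) b≤d)
      (InRange-raise m<n (++⁻ˡ X n≤XY) rX) (InRange-raise m<n (++⁻ʳ X n≤XY) rY)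

-- Appending a symbol

split-++ : ∀ m A {B q qs} → split m B ≡ q ∷ qs →
           ∃₂ λ ps p → split m A ≡ ps ++ [ p ] × split m (A ++ B) ≡ ps ++ (p ++ q) ∷ qs
split-++ m []       eq = [] , [] , refl , eq
split-++ m (x ∷ xs) {B} eq with x ≟ m | split m xs | split m (xs ++ B) | split-++ m xs {B} eq
... | yes _ | _ | _ | ps     , p , refl , refl = [] ∷ ps , p , refl , refl
... | no  _ | _ | _ | []     , p , refl , refl = [] , x ∷ p , refl , refl
... | no  _ | _ | _ | r ∷ rs , p , refl , refl = (x ∷ r) ∷ rs , p , refl , refl

split-[m] : ∀ m → split m [ m ] ≡ [] ∷ [ [] ]
split-[m] m with m ≟ m
... | yes _   = refl
... | no  m≢m = ⊥-elim (m≢m refl)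

split-snoc-≡ : ∀ m A → split m (A ++ [ m ]) ≡ split m A ++ [ [] ]
split-snoc-≡ m A with split-++ m A (split-[m] m)
... | ps , p , eq , eq′ = begin
  split m (A ++ [ m ])    ≡⟨ eq′ ⟩
  ps ++ (p ++ []) ∷ [ [] ] ≡⟨ cong (λ p′ → ps ++ p′ ∷ [ [] ]) (++-identityʳ p) ⟩
  ps ++ p ∷ [ [] ]        ≡⟨ ++-assoc ps [ p ] [ [] ] ⟨
  (ps ++ [ p ]) ++ [ [] ] ≡⟨ cong (_++ [ [] ]) eq ⟨
  split m A ++ [ [] ]     ∎

maxSubseq-map-snoc : ∀ {A : Set} (key : A → Tree) xs x →
  maxSubseq id (map key (xs ++ [ x ])) ≡ snocMax (maxSubseq id (map key xs)) (key x)
maxSubseq-map-snoc key xs x =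
  trans (cong (maxSubseq id) (map-++ key xs [ x ])) (maxSubseq-snoc (map key xs) (key x))

children-tree-snoc-≡ : ∀ d m A →
  children (tree (suc d) m (A ++ [ m ])) ≡ snocMax (children (tree (suc d) m A)) (tree d (suc m) [])
children-tree-snoc-≡ d m A =
  trans (cong (maxSubseq id ∘ map (tree d (suc m))) (split-snoc-≡ m A))
        (maxSubseq-map-snoc (tree d (suc m)) (split m A) [])

children-tree-snoc-≢ : ∀ d {m n} → n ≢ m → ∀ A → ∃₂ λ r p →
  children (tree (suc d) m A) ≡ snocMax r (tree d (suc m) p) ×
  children (tree (suc d) m (A ++ [ n ])) ≡ snocMax r (tree d (suc m) (p ++ [ n ]))
children-tree-snoc-≢ d {m} {n} n≢m A with split-++ m A (split-fresh m [ n ] (n≢m ∷ []))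
... | ps , p , eq , eq′ =
  maxSubseq id (map t ps) , p ,
  trans (cong (maxSubseq id ∘ map t) eq) (maxSubseq-map-snoc t ps p) ,
  trans (cong (maxSubseq id ∘ map t) eq′) (maxSubseq-map-snoc t ps (p ++ [ n ]))
  where t = tree d (suc m)

split-nonempty : ∀ m X → ∃₂ λ s ss → split m X ≡ s ∷ ss
split-nonempty m []       = [] , [] , refl
split-nonempty m (x ∷ xs) with x ≟ m | split m xs
... | yes _ | ss     = [] , ss , refl
... | no  _ | []     = [ x ] , [] , refl
... | no  _ | s ∷ ss = x ∷ s , ss , refl

tree-[]-minimum : ∀ d m X → tree d m [] ≤ₜ tree d m X
tree-[]-minimum zero    m X = tt
tree-[]-minimum (suc d) m X with split-nonempty m X
... | s , ss , eq rewrite eq =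
  ≤ₗ-trans {[ t [] ]} {[ t s ]} {maxSubseq id (map t (s ∷ ss))}
    (∷-mono-≤ₗ {t []} {t s} {[]} {[]} (tree-[]-minimum d (suc m) s) tt)
    (⊆⇒≤ₗ-maxSubseq {[ t s ]} (refl ∷ minimum (map t ss)))
  where t = tree d (suc m)

tree-snoc-< : ∀ d m n A → m ≤ n → n < m + d → tree d m A <ₜ tree d m (A ++ [ n ])
tree-snoc-< zero    m n A m≤n n<m+0 = ⊥-elim (¬InRange-∷ n<m+0 ((m≤n , ≤-refl) ∷ []))
tree-snoc-< (suc d) m n A m≤n n<m+d with m≤n⇒m<n∨m≡n m≤n
... | inj₂ refl =
  subst (children (tree (suc d) m A) <ₗ_) (sym (children-tree-snoc-≡ d m A))
    (<ₗ-snocMax-minimum (All-resp-⊆ (maxSubseq-⊆ id _)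
      (All-map⁺ (All.universal (tree-[]-minimum d (suc m)) (split m A)))))
... | inj₁ m<n with children-tree-snoc-≢ d (≢-sym (<⇒≢ m<n)) A
...   | r , p , eq , eq′ =
  subst₂ _<ₗ_ (sym eq) (sym eq′)
    (snocMax-<ₗ r (tree-snoc-< d (suc m) n p m<n (subst (n <_) (+-suc m d) n<m+d)))

-- For n > m only the last piece p grows, to p n, whose tree is larger; snocMax-absorb then
-- makes the new children a function of the old ones.
tree-snoc-cong : ∀ d m n A₁ A₂ → m ≤ n → n < m + d →
  tree d m A₁ ≡ tree d m A₂ → tree d m (A₁ ++ [ n ]) ≡ tree d m (A₂ ++ [ n ])
tree-snoc-cong zero    m n A₁ A₂ m≤n n<m+d _ = refl
tree-snoc-cong (suc d) m n A₁ A₂ m≤n n<m+d eq with m≤n⇒m<n∨m≡n m≤n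
... | inj₂ refl = cong node (begin
  children (tree (suc d) m (A₁ ++ [ m ]))        ≡⟨ children-tree-snoc-≡ d m A₁ ⟩
  snocMax (children (tree (suc d) m A₁)) (t [])  ≡⟨ cong (λ u → snocMax (children u) (t [])) eq ⟩
  snocMax (children (tree (suc d) m A₂)) (t [])  ≡⟨ children-tree-snoc-≡ d m A₂ ⟨
  children (tree (suc d) m (A₂ ++ [ m ]))        ∎)
  where t = tree d (suc m)
... | inj₁ m<n
  with children-tree-snoc-≢ d (≢-sym (<⇒≢ m<n)) A₁ | children-tree-snoc-≢ d (≢-sym (<⇒≢ m<n)) A₂
...   | r₁ , p₁ , eq₁ , eq₁′ | r₂ , p₂ , eq₂ , eq₂′ = cong node (begin
  children (tree (suc d) m (A₁ ++ [ n ]))          ≡⟨ eq₁′ ⟩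
  snocMax r₁ (t (p₁ ++ [ n ]))                     ≡⟨ snocMax-absorb r₁ (snoc-< p₁) ⟨
  snocMax (snocMax r₁ (t p₁)) (t (p₁ ++ [ n ]))    ≡⟨ cong₂ snocMax last-pieces ih ⟩
  snocMax (snocMax r₂ (t p₂)) (t (p₂ ++ [ n ]))    ≡⟨ snocMax-absorb r₂ (snoc-< p₂) ⟩
  snocMax r₂ (t (p₂ ++ [ n ]))                     ≡⟨ eq₂′ ⟨
  children (tree (suc d) m (A₂ ++ [ n ]))          ∎)
  where
  t = tree d (suc m)
  n<m+d′ = subst (n <_) (+-suc m d) n<m+d
  snoc-< : ∀ p → t p <ₜ t (p ++ [ n ])
  snoc-< p = tree-snoc-< d (suc m) n p m<n n<m+d′
  last-pieces : snocMax r₁ (t p₁) ≡ snocMax r₂ (t p₂)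
  last-pieces = trans (sym eq₁) (trans (cong children eq) eq₂)
  ih : t (p₁ ++ [ n ]) ≡ t (p₂ ++ [ n ])
  ih = tree-snoc-cong d (suc m) n p₁ p₂ m<n n<m+d′ (snocMax-injectiveʳ r₁ r₂ last-pieces)

maxW-upperBound : ∀ L → All (_≤ maxW L) L
maxW-upperBound []       = []
maxW-upperBound (x ∷ xs) = m≤m⊔n x (maxW xs) ∷ All.map (m≤n⇒m≤o⊔n x) (maxW-upperBound xs)

maxW-least : ∀ {k} L → All (_≤ k) L → maxW L ≤ k
maxW-least []       []           = z≤n
maxW-least (x ∷ xs) (x≤k ∷ xs≤k) = ⊔-lub x≤k (maxW-least xs xs≤k)

≾⇔tree : ∀ {k X Y} → All (_≤ k) X → All (_≤ k) Y →
         X ≾ Y ⇔ tree (suc k) 0 X ≤ₜ tree (suc k) 0 Y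
≾⇔tree {k} {X} {Y} X≤k Y≤k =
  rel⇔tree b (suc k) 0 b X Y ≤-refl (s≤s (maxW-least (X ++ Y) (++⁺ X≤k Y≤k)))
    (inRange (++⁻ˡ X ub)) (inRange (++⁻ʳ X ub))
  where
  b  = suc (maxW (X ++ Y))
  ub = maxW-upperBound (X ++ Y)
  inRange : ∀ {Z} → All (_≤ maxW (X ++ Y)) Z → InRange 0 b Z
  inRange = All.map (λ z≤ → z≤n , s≤s z≤)

∼⇔tree-≡ : ∀ {k X Y} → All (_≤ k) X → All (_≤ k) Y →
           X ∼ Y ⇔ tree (suc k) 0 X ≡ tree (suc k) 0 Y
∼⇔tree-≡ X≤k Y≤k = mk⇔
  (λ (X≾Y , Y≾X) → ≤ₜ-antisym (to (≾⇔tree X≤k Y≤k) X≾Y) (to (≾⇔tree Y≤k X≤k) Y≾X))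
  (λ X≡Y → from (≾⇔tree X≤k Y≤k) (≤ₜ-reflexive X≡Y) ,
           from (≾⇔tree Y≤k X≤k) (≤ₜ-reflexive (sym X≡Y)))

∼-snoc : ∀ n {A₁ A₂} → A₁ ∼ A₂ → (A₁ ++ [ n ]) ∼ (A₂ ++ [ n ])
∼-snoc n {A₁} {A₂} A₁∼A₂ =
  from (∼⇔tree-≡ (++⁺ A₁≤k (n≤k ∷ [])) (++⁺ A₂≤k (n≤k ∷ [])))
    (tree-snoc-cong (suc k) 0 n A₁ A₂ z≤n (s≤s n≤k) (to (∼⇔tree-≡ A₁≤k A₂≤k) A₁∼A₂))
  where
  k = maxW (A₁ ++ A₂) ⊔ n
  A≤k = All.map (m≤n⇒m≤n⊔o n) (maxW-upperBound (A₁ ++ A₂))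
  A₁≤k = ++⁻ˡ A₁ A≤k
  A₂≤k = ++⁻ʳ A₁ A≤k
  n≤k = m≤n⊔m (maxW (A₁ ++ A₂)) n

∼-trans : ∀ {X Y Z} → X ∼ Y → Y ∼ Z → X ∼ Z
∼-trans {X} {Y} {Z} X∼Y Y∼Z =
  from (∼⇔tree-≡ X≤k Z≤k) (trans (to (∼⇔tree-≡ X≤k Y≤k) X∼Y) (to (∼⇔tree-≡ Y≤k Z≤k) Y∼Z))
  where
  XYZ≤k = maxW-upperBound (X ++ Y ++ Z)
  X≤k = ++⁻ˡ X XYZ≤k
  Y≤k = ++⁻ˡ Y (++⁻ʳ X XYZ≤k)
  Z≤k = ++⁻ʳ Y (++⁻ʳ X XYZ≤k)

proposition1 :
    ((n : ℕ) (A₁ A₂ : Word) → A₁ ∼ A₂ → (A₁ ++ [ n ]) ∼ (A₂ ++ [ n ]))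
    × ((n : ℕ) (A₁ A₂ : Word) → NF A₁ → A₁ ∼ A₂ →
       (D : Word) → IsDiamond n A₁ D → D ∼ (A₂ ++ [ n ]))
proposition1 =
  (λ n _ _ → ∼-snoc n) ,
  (λ n _ _ _ A₁∼A₂ _ (_ , D∼A₁n) → ∼-trans D∼A₁n (∼-snoc n A₁∼A₂))
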